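{- For every base $\mathcal{B}$, atomic multisets $L,K$ and formulae $\varphi,\psi,\chi$: if $\Vdash^{L}_{\mathcal{B}}\varphi\otimes\psi$ and $\{\varphi,\psi\}\Vdash^{K}_{\mathcal{B}}\chi$, then $\Vdash^{L\uplus K}_{\mathcal{B}}\chi$.
   Context: Fix a set $\mathbb{A}$ of propositional atoms. All multisets are finite; $\uplus$ denotes multiset union; an atomic multiset is a finite multiset of atoms. Formulae: $\varphi ::= p\in\mathbb{A}\mid\top\mid 0\mid 1\mid\varphi\multimap\varphi\mid\varphi\otimes\varphi\mid\varphi\mathbin{\&}\varphi\mid\varphi\oplus\varphi\mid\,!\varphi$. Bases. An atomic sequent is a pair $P\Rightarrow p$ ($P$ atomic multiset, $p$ atom); an atomic box is a finite multiset of atomic sequents; an atomic rule is a triple $\langle\mathbf{A},\mathbf{S},p\rangle$ with $\mathbf{A}$ a finite multiset of atomic boxes, $\mathbf{S}$ an atomic box, $p$ an atom. A base is a set of atomic rules; $\mathcal{C}\supseteq\mathcal{B}$ is set inclusion. An atom $p$ is persistent in $\mathcal{B}$ if $\mathcal{B}$ contains a rule $\langle\varnothing,\mathbf{S},p\rangle$ with $\mathbf{S}\neq\varnothing$. Derivability $P\vdash_{\mathcal{B}}p$ is the smallest relation closed under: (Ref) $\{p\}\vdash_{\mathcal{B}}p$; (App) if $\langle\mathbf{A},\mathbf{S},p\rangle\in\mathcal{B}$ with $\mathbf{A}=\{\mathbf{T}_1,\dots,\mathbf{T}_m\}$, and there are $n\ge m$, atomic multisets $C_1,\dots,C_n$ and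 a multiset $D=\{d_{m+1},\dots,d_n\}$ of atoms persistent in $\mathcal{B}$ with $C_i\uplus Q\vdash_{\mathcal{B}}q$ for all $i\le m$ and $Q\Rightarrow q\in\mathbf{T}_i$, $C_j\vdash_{\mathcal{B}}d_j$ for all $m<j\le n$, and $D\uplus U\vdash_{\mathcal{B}}v$ for all $U\Rightarrow v\in\mathbf{S}$, then $C_1\uplus\dots\uplus C_n\vdash_{\mathcal{B}}p$. Support. For a base $\mathcal{B}$, atomic multiset $L$: (At) $\Vdash^L_{\mathcal{B}}p$ iff $L\vdash_{\mathcal{B}}p$; ($\multimap$) $\Vdash^L_{\mathcal{B}}\varphi\multimap\psi$ iff $\varphi\Vdash^L_{\mathcal{B}}\psi$; ($\otimes$) $\Vdash^L_{\mathcal{B}}\varphi\otimes\psi$ iff for all $\mathcal{C}\supseteq\mathcal{B}$, atomic multisets $K$, atoms $p$: if $\{\varphi,\psi\}\Vdash^K_{\mathcal{C}}p$ then $\Vdash^{L\uplus K}_{\mathcal{C}}p$; ($1$) $\Vdash^L_{\mathcal{B}}1$ iff for all $\mathcal{C}\supseteq\mathcal{B}$, $K$, $p$: if $\Vdash^K_{\mathcal{C}}p$ then $\Vdash^{L\uplus K}_{\mathcal{C}}p$; ($\mathbin{\&}$) $\Vdash^L_{\mathcal{B}}\varphi\mathbin{\&}\psi$ iff $\Vdash^L_{\mathcal{B}}\varphi$ and $\Vdash^L_{\mathcal{B}}\psi$; ($\oplus$) $\Vdash^L_{\mathcal{B}}\varphi\oplus\psi$ iff for all $\mathcal{C}\supseteq\mathcal{B}$,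 $K$, $p$: if $\varphi\Vdash^K_{\mathcal{C}}p$ and $\psi\Vdash^K_{\mathcal{C}}p$ then $\Vdash^{L\uplus K}_{\mathcal{C}}p$; ($0$) $\Vdash^L_{\mathcal{B}}0$ iff $\Vdash^{L\uplus K}_{\mathcal{B}}p$ for all atoms $p$ and atomic multisets $K$; ($\top$) $\Vdash^L_{\mathcal{B}}\top$ always; ($!$) $\Vdash^L_{\mathcal{B}}\,!\varphi$ iff for all $\mathcal{C}\supseteq\mathcal{B}$, $K$, $p$: if (for all $\mathcal{D}\supseteq\mathcal{C}$, $\Vdash^{\varnothing}_{\mathcal{D}}\varphi$ implies $\Vdash^K_{\mathcal{D}}p$) then $\Vdash^{L\uplus K}_{\mathcal{C}}p$. Multisets: $\Vdash^L_{\mathcal{B}}\varnothing$ iff $L=\varnothing$; $\Vdash^L_{\mathcal{B}}\{\varphi\}$ iff $\Vdash^L_{\mathcal{B}}\varphi$; $\Vdash^L_{\mathcal{B}}\Gamma\uplus\Delta$ iff $L=K\uplus M$ for some $K,M$ with $\Vdash^K_{\mathcal{B}}\Gamma$, $\Vdash^M_{\mathcal{B}}\Delta$. (Inf) For non-empty $\Gamma$, write $\Gamma=\,!\Delta\uplus\Theta$ with $!\Delta$ the elements whose top-level connective is $!$ and $\Theta$ the rest; $\Gamma\Vdash^L_{\mathcal{B}}\varphi$ iff for all $\mathcal{C}\supseteq\mathcal{B}$ and atomic $K$: if $\Vdash^{\varnothing}_{\mathcal{C}}\delta$ for every $\delta\in\Delta$ and $\Vdash^K_{\mathcal{C}}\Theta$,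 then $\Vdash^{L\uplus K}_{\mathcal{C}}\varphi$. For $\Gamma=\varnothing$, $\Gamma\Vdash^L_{\mathcal{B}}\varphi$ means $\Vdash^L_{\mathcal{B}}\varphi$. -}

module Defs where

open import Level using (Level; Lift; lift) renaming (suc to lsuc; zero to lzero)
open import Data.List using (List; []; _∷_; [_]; _++_; concat; map)
open import Data.List.Relation.Unary.All using (All)
open import Data.List.Relation.Binary.Pointwise.Base using (Pointwise)
open import Data.List.Relation.Binary.Permutation.Propositional using (_↭_)
open import Data.Product using (_×_; _,_; proj₁; proj₂; ∃; ∃-syntax)
open import Data.Sum using (_⊎_; inj₁; inj₂)
open import Data.Unit using (⊤)
open import Relation.Binary.PropositionalEquality using (_≢_)

module _ (Atom : Set) where



  -- Finite multisets are represented by lists, compared up to permutation (_↭_).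

  AtomMS : Set
  AtomMS = List Atom

  Sequent : Set
  Sequent = AtomMS × Atom

  Box : Set
  Box = List Sequent

  record Rule : Set where
    constructor ⟨_,_,_⟩
    field
      premises : List Box
      discharge : Box
      head : Atom

  Base : Set₁
  Base = Rule → Set

  _⊇_ : Base → Base → Set
  C ⊇ B = ∀ r → B r → C r

  Persistent : Base → Atom → Set
  Persistent B p = ∃[ S ] (S ≢ [] × B ⟨ [] , S , p ⟩)

  data Derives (B : Base) : AtomMS → Atom → Set where
    ref : ∀ {L p} → L ↭ [ p ] → Derives B L p
    app : ∀ {A S p L}
        → B ⟨ A , S , p ⟩
        → (Cs : List AtomMS)
        → (Es : List (AtomMS × Atom))        -- (C_j , d_j) for m < j ≤ n
        → Pointwise (λ C T → All (λ s → Derives B (C ++ proj₁ s) (proj₂ s)) T) Cs A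
        → All (λ e → Persistent B (proj₂ e) × Derives B (proj₁ e) (proj₂ e)) Es
        → All (λ s → Derives B (map proj₂ Es ++ proj₁ s) (proj₂ s)) S
        → L ↭ concat Cs ++ concat (map proj₁ Es)
        → Derives B L p

  infixr 5 _⊸_
  infixr 6 _⊗_ _&_ _⊕_
  data Formula : Set where
    atom : Atom → Formula
    ⊤′ 𝟘 𝟙 : Formula
    _⊸_ _⊗_ _&_ _⊕_ : Formula → Formula → Formula
    !_ : Formula → Formula

  Sem : Set₂
  Sem = Base → AtomMS → Set₁

  -- Hypotheses are tagged: inj₁ s for a !-formula !δ (s = support of δ),
  -- inj₂ s for any other formula (s = its support).
  Hyp : Set₂
  Hyp = Sem ⊎ Sem

  bangs : List Hyp → List Sem
  bangs [] = []
  bangs (inj₁ s ∷ hs) = s ∷ bangs hs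
  bangs (inj₂ _ ∷ hs) = bangs hs

  others : List Hyp → List Sem
  others [] = []
  others (inj₁ _ ∷ hs) = others hs
  others (inj₂ s ∷ hs) = s ∷ others hs

  SuppMS : Base → AtomMS → List Sem → Set₁
  SuppMS B L [] = Lift (lsuc lzero) (L ↭ [])
  SuppMS B L (s ∷ []) = s B L
  SuppMS B L (s ∷ s′ ∷ ss) =
    ∃[ K ] ∃[ M ] (Lift (lsuc lzero) (L ↭ K ++ M) × s B K × SuppMS B M (s′ ∷ ss))

  AllEmpty : Base → List Sem → Set₁
  AllEmpty C [] = Lift (lsuc lzero) ⊤
  AllEmpty C (δ ∷ Δ) = δ C [] × AllEmpty C Δ

  -- (Inf), for a non-empty multiset Γ = !Δ ⊎ Θ
  InfS : Base → AtomMS → List Hyp → Sem → Set₁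
  InfS B L Γ φ = ∀ (C : Base) → C ⊇ B → ∀ (K : AtomMS)
    → AllEmpty C (bangs Γ)
    → SuppMS C K (others Γ)
    → φ C (L ++ K)

  AtSem : Atom → Sem
  AtSem p B L = Lift (lsuc lzero) (Derives B L p)

  mutual
    ⟦_⟧ : Formula → Sem
    ⟦ atom p ⟧ B L = AtSem p B L
    ⟦ φ ⊸ ψ ⟧ B L = InfS B L (classify φ ∷ []) ⟦ ψ ⟧
    ⟦ φ ⊗ ψ ⟧ B L = ∀ (C : Base) → C ⊇ B → ∀ (K : AtomMS) (p : Atom)
      → InfS C K (classify φ ∷ classify ψ ∷ []) (AtSem p) → AtSem p C (L ++ K)
    ⟦ 𝟙 ⟧ B L = ∀ (C : Base) → C ⊇ B → ∀ (K : AtomMS) (p : Atom)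
      → AtSem p C K → AtSem p C (L ++ K)
    ⟦ φ & ψ ⟧ B L = ⟦ φ ⟧ B L × ⟦ ψ ⟧ B L
    ⟦ φ ⊕ ψ ⟧ B L = ∀ (C : Base) → C ⊇ B → ∀ (K : AtomMS) (p : Atom)
      → InfS C K (classify φ ∷ []) (AtSem p)
      → InfS C K (classify ψ ∷ []) (AtSem p)
      → AtSem p C (L ++ K)
    ⟦ 𝟘 ⟧ B L = ∀ (p : Atom) (K : AtomMS) → AtSem p B (L ++ K)
    ⟦ ⊤′ ⟧ B L = Lift (lsuc lzero) ⊤
    ⟦ ! φ ⟧ B L = ∀ (C : Base) → C ⊇ B → ∀ (K : AtomMS) (p : Atom)
      → (∀ (D : Base) → D ⊇ C → ⟦ φ ⟧ D [] → AtSem p D K)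
      → AtSem p C (L ++ K)

    classify : Formula → Hyp
    classify (! δ) = inj₁ ⟦ δ ⟧
    classify γ = inj₂ ⟦ γ ⟧

  _⊩[_]_ : Base → AtomMS → Formula → Set₁
  B ⊩[ L ] φ = ⟦ φ ⟧ B L

  _⊢[_,_]_ : List Formula → Base → AtomMS → Formula → Set₁
  [] ⊢[ B , L ] φ = ⟦ φ ⟧ B L
  (γ ∷ Γ) ⊢[ B , L ] φ = InfS B L (map classify (γ ∷ Γ)) ⟦ φ ⟧

{-# OPTIONS --safe #-}
-- The clause for ⊩^L_B φ ⊗ ψ only lets φ, ψ be cut against atomic conclusions;
-- the cut extends to every conclusion χ by induction on χ.  Apart from ⊤ and &,
-- every clause of support quantifies over extensions C ⊇ B and further resources
-- M and ends in an atomic conclusion (𝟘, 𝟙, ⊗, ⊕, !) or in a smaller formula (⊸);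
-- there the cut is applied, atomically or inductively, with K ⊎ M in place of K.
-- This needs support to be monotone in the base and invariant under permuting
-- the resources.
module Submission where

open import Defs
open import Algebra.Bundles using (CommutativeMonoid)
import Algebra.Properties.CommutativeSemigroup as CommutativeSemigroupProperties
open import Data.List using (List; []; _∷_; _++_)
open import Data.List.Relation.Unary.All using (All; []; _∷_)
open import Data.List.Relation.Binary.Pointwise.Base using (Pointwise; []; _∷_)
open import Data.List.Relation.Binary.Permutation.Propositional using (_↭_; ↭-sym; ↭-trans)
open import Data.List.Relation.Binary.Permutation.Propositional.Properties
  using (++⁺ʳ; ++-assoc; ++-commutativeMonoid)
open import Data.Product using (_×_; _,_; proj₁; proj₂; map; map₁; map₂; uncurry)
open import Data.Unit using (tt)
open import Function using (_∘_)
open import Level using (lift)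

module _ {Atom : Set} where

  open CommutativeSemigroupProperties
    (CommutativeMonoid.commutativeSemigroup (++-commutativeMonoid {A = Atom}))
    using (xy∙z≈xz∙y)

  infix 4 _⊒_
  _⊒_ : Base Atom → Base Atom → Set
  _⊒_ = _⊇_ Atom

  ⟦_⟧′ : Formula Atom → Sem Atom
  ⟦_⟧′ = ⟦_⟧ Atom

  private variable
    B C C′ : Base Atom
    K L L′ M : AtomMS Atom
    p : Atom
    s : Sem Atom
    X : Base Atom → AtomMS Atom → Atom → Set₁

  ⊒-refl : B ⊒ B
  ⊒-refl _ r = r

  ⊒-trans : C ⊒ B → C′ ⊒ C → C′ ⊒ B
  ⊒-trans C⊒B C′⊒C r = C′⊒C r ∘ C⊒B r

  Derives-resp-↭ : L ↭ L′ → Derives Atom B L p → Derives Atom B L′ p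
  Derives-resp-↭ π (ref e) = ref (↭-trans (↭-sym π) e)
  Derives-resp-↭ π (app r Cs Es boxes persistent discharged e) =
    app r Cs Es boxes persistent discharged (↭-trans (↭-sym π) e)

  AtSem-resp-↭ : L ↭ L′ → AtSem Atom p B L → AtSem Atom p B L′
  AtSem-resp-↭ π (lift d) = lift (Derives-resp-↭ π d)

  module _ (C⊒B : C ⊒ B) where
    mutual
      Derives-mono : Derives Atom B L p → Derives Atom C L p
      Derives-mono (ref e) = ref e
      Derives-mono (app r Cs Es boxes persistent discharged e) =
        app (C⊒B _ r) Cs Es (boxes-mono boxes) (persistent-mono persistent)
            (box-mono discharged) e

      private
        box-mono : ∀ {P T} → All (λ s → Derives Atom B (P ++ proj₁ s) (proj₂ s)) T
                           → All (λ s → Derives Atom C (P ++ proj₁ s) (proj₂ s)) T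
        box-mono [] = []
        box-mono (d ∷ ds) = Derives-mono d ∷ box-mono ds

        boxes-mono : ∀ {Ps A}
          → Pointwise (λ P T → All (λ s → Derives Atom B (P ++ proj₁ s) (proj₂ s)) T) Ps A
          → Pointwise (λ P T → All (λ s → Derives Atom C (P ++ proj₁ s) (proj₂ s)) T) Ps A
        boxes-mono [] = []
        boxes-mono (ds ∷ dss) = box-mono ds ∷ boxes-mono dss

        persistent-mono : ∀ {Es}
          → All (λ e → Persistent Atom B (proj₂ e) × Derives Atom B (proj₁ e) (proj₂ e)) Es
          → All (λ e → Persistent Atom C (proj₂ e) × Derives Atom C (proj₁ e) (proj₂ e)) Es
        persistent-mono [] = []
        persistent-mono (((S , S≢[] , r) , d) ∷ ds) =
          ((S , S≢[] , C⊒B _ r) , Derives-mono d) ∷ persistent-mono ds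

  Monotone : Sem Atom → Set₁
  Monotone s = ∀ {B C L} → C ⊒ B → s B L → s C L

  -- The shape of the clauses for 𝟙, ⊗ and !, and (up to currying) for ⊕.
  Elim : (Base Atom → AtomMS Atom → Atom → Set₁) → Sem Atom
  Elim X B L = ∀ C → C ⊒ B → ∀ K p → X C K p → AtSem Atom p C (L ++ K)

  Elim-mono : Monotone (Elim X)
  Elim-mono C⊒B e C′ C′⊒C = e C′ (⊒-trans C⊒B C′⊒C)

  Elim-resp-↭ : L ↭ L′ → Elim X B L → Elim X B L′
  Elim-resp-↭ π e C C⊒B K p x = AtSem-resp-↭ (++⁺ʳ K π) (e C C⊒B K p x)

  InfS-mono : ∀ Γ → C ⊒ B → InfS Atom B L Γ s → InfS Atom C L Γ s
  InfS-mono _ C⊒B f C′ C′⊒C = f C′ (⊒-trans C⊒B C′⊒C)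

  ⟦⟧-mono : ∀ χ → Monotone ⟦ χ ⟧′
  ⟦⟧-mono (atom p) C⊒B (lift d) = lift (Derives-mono C⊒B d)
  ⟦⟧-mono ⊤′ _ x = x
  ⟦⟧-mono 𝟘 C⊒B x p K = ⟦⟧-mono (atom p) C⊒B (x p K)
  ⟦⟧-mono 𝟙 C⊒B x C′ C′⊒C = x C′ (⊒-trans C⊒B C′⊒C)
  ⟦⟧-mono (χ ⊸ χ′) C⊒B x C′ C′⊒C = x C′ (⊒-trans C⊒B C′⊒C)
  ⟦⟧-mono (χ ⊗ χ′) C⊒B x C′ C′⊒C = x C′ (⊒-trans C⊒B C′⊒C)
  ⟦⟧-mono (χ & χ′) C⊒B = map (⟦⟧-mono χ C⊒B) (⟦⟧-mono χ′ C⊒B)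
  ⟦⟧-mono (χ ⊕ χ′) C⊒B x C′ C′⊒C = x C′ (⊒-trans C⊒B C′⊒C)
  ⟦⟧-mono (! χ) C⊒B x C′ C′⊒C = x C′ (⊒-trans C⊒B C′⊒C)

  ⟦⟧-resp-↭ : ∀ χ {B} → L ↭ L′ → ⟦ χ ⟧′ B L → ⟦ χ ⟧′ B L′
  ⟦⟧-resp-↭ (atom p) = AtSem-resp-↭
  ⟦⟧-resp-↭ ⊤′ _ x = x
  ⟦⟧-resp-↭ 𝟘 π x p K = AtSem-resp-↭ (++⁺ʳ K π) (x p K)
  ⟦⟧-resp-↭ 𝟙 = Elim-resp-↭
  ⟦⟧-resp-↭ (χ ⊸ χ′) π f C C⊒B K δs θs = ⟦⟧-resp-↭ χ′ (++⁺ʳ K π) (f C C⊒B K δs θs)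
  ⟦⟧-resp-↭ (χ ⊗ χ′) = Elim-resp-↭
  ⟦⟧-resp-↭ (χ & χ′) π = map (⟦⟧-resp-↭ χ π) (⟦⟧-resp-↭ χ′ π)
  ⟦⟧-resp-↭ (χ ⊕ χ′) π x C C⊒B K p y z = AtSem-resp-↭ (++⁺ʳ K π) (x C C⊒B K p y z)
  ⟦⟧-resp-↭ (! χ) = Elim-resp-↭

  Premises : List (Hyp Atom) → Base Atom → AtomMS Atom → Set₁
  Premises Γ C K = AllEmpty Atom C (bangs Atom Γ) × SuppMS Atom C K (others Atom Γ)

  premise-mono : ∀ γ → C′ ⊒ C
               → Premises (classify Atom γ ∷ []) C K → Premises (classify Atom γ ∷ []) C′ K
  premise-mono (! δ) C′⊒C = map₁ (map₁ (⟦⟧-mono δ C′⊒C))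
  premise-mono γ@(atom _) C′⊒C = map₂ (⟦⟧-mono γ C′⊒C)
  premise-mono ⊤′ _ premise = premise
  premise-mono γ@𝟘 C′⊒C = map₂ (⟦⟧-mono γ C′⊒C)
  premise-mono γ@𝟙 C′⊒C = map₂ (⟦⟧-mono γ C′⊒C)
  premise-mono γ@(_ ⊸ _) C′⊒C = map₂ (⟦⟧-mono γ C′⊒C)
  premise-mono γ@(_ ⊗ _) C′⊒C = map₂ (⟦⟧-mono γ C′⊒C)
  premise-mono γ@(_ & _) C′⊒C = map₂ (⟦⟧-mono γ C′⊒C)
  premise-mono γ@(_ ⊕ _) C′⊒C = map₂ (⟦⟧-mono γ C′⊒C)

  InfS-frame : ∀ Γ χ → C ⊒ B → InfS Atom B K Γ s
             → (∀ {C′ N} → C′ ⊒ C → s C′ (K ++ N) → ⟦ χ ⟧′ C′ ((K ++ N) ++ M))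
             → InfS Atom C (K ++ M) Γ ⟦ χ ⟧′
  InfS-frame {K = K} {M = M} _ χ C⊒B f g C′ C′⊒C N δs θs =
    ⟦⟧-resp-↭ χ (xy∙z≈xz∙y K N M) (g C′⊒C (f C′ (⊒-trans C⊒B C′⊒C) N δs θs))

  -- ⊩^L_B φ ⊗ ψ is AtomicCut (classify φ ∷ classify ψ ∷ []) B L.
  AtomicCut : List (Hyp Atom) → Sem Atom
  AtomicCut Γ = Elim (λ C K p → InfS Atom C K Γ (AtSem Atom p))

  atomicCut⇒cutElim : ∀ Γ → (∀ {C C′ K p} → C′ ⊒ C → X C K p → X C′ K p)
                    → AtomicCut Γ B L → InfS Atom B K Γ (Elim X) → Elim X B (L ++ K)
  atomicCut⇒cutElim {X = X} {L = L} {K = K} Γ X-mono cut f C C⊒B M p x =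
    AtSem-resp-↭ (↭-sym (++-assoc L K M))
      (cut C C⊒B (K ++ M) p (InfS-frame {s = Elim X} Γ (atom p) C⊒B f
        λ C′⊒C e → e _ ⊒-refl M p (X-mono C′⊒C x)))

  atomicCut⇒cut : ∀ Γ χ → AtomicCut Γ B L → InfS Atom B K Γ ⟦ χ ⟧′ → ⟦ χ ⟧′ B (L ++ K)
  atomicCut⇒cut {K = K} _ (atom p) cut f = cut _ ⊒-refl K p f
  atomicCut⇒cut _ ⊤′ _ _ = lift tt
  atomicCut⇒cut {L = L} {K = K} Γ 𝟘 cut f p M =
    AtSem-resp-↭ (↭-sym (++-assoc L K M))
      (cut _ ⊒-refl (K ++ M) p (InfS-frame {s = ⟦ 𝟘 ⟧′} Γ (atom p) ⊒-refl f λ _ e → e p M))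
  atomicCut⇒cut Γ 𝟙 = atomicCut⇒cutElim Γ (λ C′⊒C → ⟦⟧-mono (atom _) C′⊒C)
  atomicCut⇒cut {L = L} {K = K} Γ (χ ⊸ χ′) cut f C C⊒B M δs θs =
    ⟦⟧-resp-↭ χ′ (↭-sym (++-assoc L K M))
      (atomicCut⇒cut Γ χ′ (Elim-mono C⊒B cut)
        (InfS-frame {s = ⟦ χ ⊸ χ′ ⟧′} Γ χ′ C⊒B f
          λ C′⊒C e → uncurry (e _ ⊒-refl M) (premise-mono χ C′⊒C (δs , θs))))
  atomicCut⇒cut Γ (χ ⊗ χ′) =
    atomicCut⇒cutElim Γ (InfS-mono {s = AtSem Atom _} (classify Atom χ ∷ classify Atom χ′ ∷ []))
  atomicCut⇒cut Γ (χ & χ′) cut f =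
    atomicCut⇒cut Γ χ cut (λ C C⊒B N δs θs → proj₁ (f C C⊒B N δs θs)) ,
    atomicCut⇒cut Γ χ′ cut (λ C C⊒B N δs θs → proj₂ (f C C⊒B N δs θs))
  atomicCut⇒cut Γ (χ ⊕ χ′) cut f C C⊒B M p x y =
    atomicCut⇒cutElim Γ (λ C′⊒C → map (InfS-mono {s = AtSem Atom _} (classify Atom χ ∷ []) C′⊒C)
                                         (InfS-mono {s = AtSem Atom _} (classify Atom χ′ ∷ []) C′⊒C)) cut
      (λ C C⊒B N δs θs C′ C′⊒C K p → uncurry (f C C⊒B N δs θs C′ C′⊒C K p))
      C C⊒B M p (x , y)
  atomicCut⇒cut Γ (! χ) =
    atomicCut⇒cutElim Γ λ D⊒C x D′ D′⊒D → x D′ (⊒-trans D⊒C D′⊒D)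

mainTheorem9 : {Atom : Set} (B : Base Atom) (L K : AtomMS Atom) (φ ψ χ : Formula Atom)
    → _⊩[_]_ Atom B L (φ ⊗ ψ)
    → _⊢[_,_]_ Atom (φ ∷ ψ ∷ []) B K χ
    → _⊩[_]_ Atom B (L ++ K) χ
mainTheorem9 {Atom} B L K φ ψ χ = atomicCut⇒cut (classify Atom φ ∷ classify Atom ψ ∷ []) χ
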